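{- Both the Cole–Davie game of Euclid and Grossman's game of Euclid are miserable and forced.
   Context: Cole–Davie Euclid: positions are pairs $(x,y)$ of non-negative integers; positions with $x=0$ or $y=0$ are terminal; from $(x,y)$ with $0<x\le y$ one may move to $(x,y-mx)$ for any positive integer $m$ with $mx\le y$, and symmetrically from $(x,y)$ with $0<y\le x$ to $(x-my,y)$ for any positive integer $m$ with $my\le x$. Grossman's Euclid: positions are pairs $(x,y)$ of positive integers; from $(x,y)$ with $x<y$ one may move to $(x,y-mx)$ for any positive integer $m$ with $y-mx\ge1$, and symmetrically when $y<x$; positions $(x,x)$ are terminal. Generally, $\operatorname{mex}(S)$ is the least non-negative integer not in $S$; the normal Sprague–Grundy function is $\mathcal{G}(x)=\operatorname{mex}\{\mathcal{G}(y): x\to y\}$ (so $0$ on terminal positions); the misère function $\mathcal{G}^-$ satisfies $\mathcal{G}^-(x)=1$ for terminal $x$ and $\mathcal{G}^-(x)=\operatorname{mex}\{\mathcal{G}^-(y): x\to y\}$ otherwise. $V_{i,j}$ is the set of positions with $\mathcal{G}=i$, $\mathcal{G}^-=j$ (an $(i,j)$-position). A position is movable to a set $W$ if it has a move to some position of $W$. A game is miserable if every position $x$ satisfies at least one of: (a) $x\in V_{0,1}\cup V_{1,0}$; (b) $x$ is not movable to $V_{0,1}\cup V_{1,0}$; (c) $x$ is movable to $V_{0,1}$ and to $V_{1,0}$. A game is forced if every move from a $(0,1)$-position leads to a $(1,0)$-position and every move from a $(1,0)$-position leads to a $(0,1)$-position. -}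

module Defs where

open import Level using (0ℓ)
open import Data.Nat using (ℕ; zero; suc; _+_; _*_; _∸_; _≤_; _<_)
open import Data.Product using (Σ; ∃; _×_; _,_; proj₁; proj₂)
open import Data.Sum using (_⊎_)
open import Relation.Nullary using (¬_)
open import Relation.Binary.PropositionalEquality using (_≡_)

record Game : Set₁ where
  field
    Pos  : Set
    _⇒_  : Pos → Pos → Set

open Game public

Terminal : (G : Game) → Pos G → Set
Terminal G p = ∀ q → ¬ (_⇒_ G p q)

IsMex : (ℕ → Set) → ℕ → Set
IsMex S n = ¬ S n × (∀ m → m < n → S m)

OptVals : (G : Game) → (Pos G → ℕ) → Pos G → ℕ → Set
OptVals G g p k = Σ (Pos G) λ q → _⇒_ G p q × g q ≡ k

IsSG : (G : Game) → (Pos G → ℕ) → Set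
IsSG G g = ∀ p → IsMex (OptVals G g p) (g p)

IsMisereSG : (G : Game) → (Pos G → ℕ) → Set
IsMisereSG G g = ∀ p → (Terminal G p → g p ≡ 1)
                     × (¬ Terminal G p → IsMex (OptVals G g p) (g p))

V : (G : Game) → (Pos G → ℕ) → (Pos G → ℕ) → ℕ → ℕ → Pos G → Set
V G g g⁻ i j p = g p ≡ i × g⁻ p ≡ j

MovableTo : (G : Game) → (Pos G → Set) → Pos G → Set
MovableTo G W p = Σ (Pos G) λ q → _⇒_ G p q × W q

Miserable : (G : Game) → (Pos G → ℕ) → (Pos G → ℕ) → Set
Miserable G g g⁻ = ∀ p →
    (V G g g⁻ 0 1 p ⊎ V G g g⁻ 1 0 p)
  ⊎ (¬ MovableTo G (λ q → V G g g⁻ 0 1 q ⊎ V G g g⁻ 1 0 q) p)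
  ⊎ (MovableTo G (V G g g⁻ 0 1) p × MovableTo G (V G g g⁻ 1 0) p)

Forced : (G : Game) → (Pos G → ℕ) → (Pos G → ℕ) → Set
Forced G g g⁻ = ∀ p q → _⇒_ G p q →
    (V G g g⁻ 0 1 p → V G g g⁻ 1 0 q) × (V G g g⁻ 1 0 p → V G g g⁻ 0 1 q)

data CDMove : ℕ × ℕ → ℕ × ℕ → Set where
  shrinkʸ : ∀ {x y} m → 0 < x → x ≤ y → 1 ≤ m → m * x ≤ y →
            CDMove (x , y) (x , y ∸ m * x)
  shrinkˣ : ∀ {x y} m → 0 < y → y ≤ x → 1 ≤ m → m * y ≤ x →
            CDMove (x , y) (x ∸ m * y , y)

ColeDavieEuclid : Game
ColeDavieEuclid = record { Pos = ℕ × ℕ ; _⇒_ = CDMove }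

record PosPair : Set where
  constructor ⟨_,_⟩∶_,_
  field
    px  : ℕ
    py  : ℕ
    px+ : 0 < px
    py+ : 0 < py

open PosPair public

GrMove : PosPair → PosPair → Set
GrMove p q =
    (px p < py p × px q ≡ px p × Σ ℕ λ m → 1 ≤ m × m * px p < py p
                                         × py q ≡ py p ∸ m * px p)
  ⊎ (py p < px p × py q ≡ py p × Σ ℕ λ m → 1 ≤ m × m * py p < px p
                                         × px q ≡ px p ∸ m * py p)

GrossmanEuclid : Game
GrossmanEuclid = record { Pos = PosPair ; _⇒_ = GrMove }

-- From (x , y) with 0 < x < y every move subtracts a multiple of x from y, and the
-- move to p₁ = (x , y − x) governs all the others: either it is the only option (up to
-- identifying terminal positions), or the options of (x , y) are exactly p₁ together
-- with the options of p₁. By induction along the moves, every position is then of one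
-- of four kinds: a (0,1)-position whose options are all (1,0), a (1,0)-position whose
-- options are all (0,1), or a position with 𝒢 = 𝒢⁻ having either no option in
-- V₀₁ ∪ V₁₀ or options in both. In the last case 𝒢 and 𝒢⁻ are the mex of the same
-- set, because the options in V₀₁ and V₁₀ contribute both 0 and 1 to each side.

module Submission where

open import Defs
open import Data.Empty using (⊥-elim)
open import Data.Nat using (ℕ; zero; suc; _+_; _*_; _∸_; _≤_; _<_; _≤?_; _<?_; z≤n; s≤s; z<s; s<s)
open import Data.Nat.Induction using (<-wellFounded)
open import Data.Nat.Properties
open import Data.Product using (_×_; _,_; proj₁; proj₂)
open import Data.Sum using (_⊎_; inj₁; inj₂)
open import Function using (flip)
open import Induction.WellFounded using (WellFounded; Acc; acc; module Subrelation)
open import Relation.Binary using (tri<; tri≈; tri>)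
import Relation.Binary.Construct.On as On
open import Relation.Binary.PropositionalEquality using (_≡_; refl; sym; trans; cong; subst)
open import Relation.Nullary using (¬_; yes; no)

mex-unique : ∀ {S T : ℕ → Set} {m n} → IsMex S m → IsMex T n →
             (∀ k → S k → T k) → (∀ k → T k → S k) → m ≡ n
mex-unique {m = m} {n} (∉S , <⇒∈S) (∉T , <⇒∈T) S⊆T T⊆S with <-cmp m n
... | tri< m<n _ _ = ⊥-elim (∉S (T⊆S m (<⇒∈T m m<n)))
... | tri≈ _ m≡n _ = m≡n
... | tri> _ _ n<m = ⊥-elim (∉T (S⊆T n (<⇒∈S n n<m)))

mex≡0 : ∀ {S : ℕ → Set} {n} → IsMex S n → ¬ S 0 → n ≡ 0
mex≡0 {n = zero}  _             _   = refl
mex≡0 {n = suc n} (_ , <⇒∈S) 0∉S = ⊥-elim (0∉S (<⇒∈S 0 z<s))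

mex≡1 : ∀ {S : ℕ → Set} {n} → IsMex S n → S 0 → ¬ S 1 → n ≡ 1
mex≡1 {n = zero}        (∉S , _)    0∈S _   = ⊥-elim (∉S 0∈S)
mex≡1 {n = suc zero}    _           _   _   = refl
mex≡1 {n = suc (suc n)} (_ , <⇒∈S) _   1∉S = ⊥-elim (1∉S (<⇒∈S 1 (s<s z<s)))

module GameShapes (G : Game) where

  infix 4 _⟶_ _≈_

  _⟶_ : Pos G → Pos G → Set
  _⟶_ = _⇒_ G

  _≈_ : Pos G → Pos G → Set
  q ≈ r = q ≡ r ⊎ (Terminal G q × Terminal G r)

  -- Only `chain` needs p₁ to have an option r: it is what makes p movable to V₁₀ when p₁ ∈ V₀₁.
  data Shape (p : Pos G) : Set where
    terminal : Terminal G p → Shape p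
    single   : ∀ {p₁} → p ⟶ p₁ → (∀ {q} → p ⟶ q → q ≈ p₁) → Shape p
    chain    : ∀ {p₁ r} → p ⟶ p₁ → p₁ ⟶ r →
               (∀ {q} → p ⟶ q → q ≈ p₁ ⊎ MovableTo G (q ≈_) p₁) →
               (∀ {r} → p₁ ⟶ r → MovableTo G (r ≈_) p) → Shape p

  ≈-sym : ∀ {q r} → q ≈ r → r ≈ q
  ≈-sym (inj₁ refl)      = inj₁ refl
  ≈-sym (inj₂ (tq , tr)) = inj₂ (tr , tq)

  module Symmetric (σ : Pos G → Pos G) (σ-involutive : ∀ p → σ (σ p) ≡ p)
                   (σ-move : ∀ {p q} → p ⟶ q → σ p ⟶ σ q) where

    σ-move⁻ : ∀ {p q} → σ p ⟶ q → p ⟶ σ q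
    σ-move⁻ {p} m = subst (_⟶ _) (σ-involutive p) (σ-move m)

    σ-terminal : ∀ {p} → Terminal G p → Terminal G (σ p)
    σ-terminal t q m = t (σ q) (σ-move⁻ m)

    σ-≈ : ∀ {q r} → q ≈ r → σ q ≈ σ r
    σ-≈ (inj₁ q≡r)       = inj₁ (cong σ q≡r)
    σ-≈ (inj₂ (tq , tr)) = inj₂ (σ-terminal tq , σ-terminal tr)

    σ-≈ˡ : ∀ {q r} → σ q ≈ r → q ≈ σ r
    σ-≈ˡ {q} s = subst (_≈ _) (σ-involutive q) (σ-≈ s)

    σ-movableTo-≈ : ∀ {p r} → MovableTo G (σ r ≈_) p → MovableTo G (r ≈_) (σ p)
    σ-movableTo-≈ (q , m , s) = σ q , σ-move m , σ-≈ˡ s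

    σ-shape : ∀ {p} → Shape p → Shape (σ p)
    σ-shape (terminal t)             = terminal (σ-terminal t)
    σ-shape (single m₁ only)         = single (σ-move m₁) (λ m → σ-≈ˡ (only (σ-move⁻ m)))
    σ-shape {p} (chain {p₁} m₁ m₁r rest back) =
      chain (σ-move m₁) (σ-move m₁r) rest′ (λ m → σ-movableTo-≈ (back (σ-move⁻ m)))
      where
      rest′ : ∀ {q} → σ p ⟶ q → q ≈ σ p₁ ⊎ MovableTo G (q ≈_) (σ p₁)
      rest′ m with rest (σ-move⁻ m)
      ... | inj₁ s  = inj₁ (σ-≈ˡ s)
      ... | inj₂ mv = inj₂ (σ-movableTo-≈ mv)

  module Classification (g g⁻ : Pos G → ℕ) (sg : IsSG G g) (msg : IsMisereSG G g⁻) where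

    V₀₁ V₁₀ Agree : Pos G → Set
    V₀₁ = V G g g⁻ 0 1
    V₁₀ = V G g g⁻ 1 0
    Agree p = g p ≡ g⁻ p

    data Classified (p : Pos G) : Set where
      zero-one : V₀₁ p → (∀ {q} → p ⟶ q → V₁₀ q) → Classified p
      one-zero : V₁₀ p → (∀ {q} → p ⟶ q → V₀₁ q) → Classified p
      isolated : Agree p → ¬ MovableTo G (λ q → V₀₁ q ⊎ V₁₀ q) p → Classified p
      balanced : Agree p → MovableTo G V₀₁ p → MovableTo G V₁₀ p → Classified p

    V₀₁⇒¬V₁₀ : ∀ {p} → V₀₁ p → ¬ V₁₀ p
    V₀₁⇒¬V₁₀ (g≡0 , _) (g≡1 , _) = 0≢1+n (trans (sym g≡0) g≡1)

    V₀₁⇒¬Agree : ∀ {p} → V₀₁ p → ¬ Agree p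
    V₀₁⇒¬Agree (g≡0 , g⁻≡1) agree = 0≢1+n (trans (sym g≡0) (trans agree g⁻≡1))

    V₁₀⇒¬Agree : ∀ {p} → V₁₀ p → ¬ Agree p
    V₁₀⇒¬Agree (g≡1 , g⁻≡0) agree = 0≢1+n (trans (sym g⁻≡0) (trans (sym agree) g≡1))

    kind : ∀ {p} → Classified p → V₀₁ p ⊎ V₁₀ p ⊎ Agree p
    kind (zero-one v _)   = inj₁ v
    kind (one-zero v _)   = inj₂ (inj₁ v)
    kind (isolated a _)   = inj₂ (inj₂ a)
    kind (balanced a _ _) = inj₂ (inj₂ a)

    terminal⇒V₀₁ : ∀ {p} → Terminal G p → V₀₁ p
    terminal⇒V₀₁ {p} t = mex≡0 (sg p) (λ (q , m , _) → t q m) , proj₁ (msg p) t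

    misère-mex : ∀ {p q} → p ⟶ q → IsMex (OptVals G g⁻ p) (g⁻ p)
    misère-mex {p} {q} m = proj₂ (msg p) (λ t → t q m)

    ≈⇒g≡ : ∀ {q r} → q ≈ r → g q ≡ g r
    ≈⇒g≡ (inj₁ refl)      = refl
    ≈⇒g≡ (inj₂ (tq , tr)) = trans (proj₁ (terminal⇒V₀₁ tq)) (sym (proj₁ (terminal⇒V₀₁ tr)))

    ≈⇒g⁻≡ : ∀ {q r} → q ≈ r → g⁻ q ≡ g⁻ r
    ≈⇒g⁻≡ (inj₁ refl)      = refl
    ≈⇒g⁻≡ (inj₂ (tq , tr)) = trans (proj₂ (terminal⇒V₀₁ tq)) (sym (proj₂ (terminal⇒V₀₁ tr)))

    ≈-V : ∀ {i j q r} → q ≈ r → V G g g⁻ i j r → V G g g⁻ i j q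
    ≈-V s (gr≡i , g⁻r≡j) = trans (≈⇒g≡ s) gr≡i , trans (≈⇒g⁻≡ s) g⁻r≡j

    ≈-Agree : ∀ {q r} → q ≈ r → Agree r → Agree q
    ≈-Agree s agree = trans (≈⇒g≡ s) (trans agree (sym (≈⇒g⁻≡ s)))

    options-V₀₁⇒V₁₀ : ∀ {p q₀} → p ⟶ q₀ → (∀ {q} → p ⟶ q → V₀₁ q) → V₁₀ p
    options-V₀₁⇒V₁₀ {p} m₀ all =
        mex≡1 (sg p) (_ , m₀ , proj₁ (all m₀)) (λ (_ , m , g≡1) → 0≢1+n (trans (sym (proj₁ (all m))) g≡1))
      , mex≡0 (misère-mex m₀) (λ (_ , m , g⁻≡0) → 0≢1+n (trans (sym g⁻≡0) (proj₂ (all m))))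

    options-V₁₀⇒V₀₁ : ∀ {p q₀} → p ⟶ q₀ → (∀ {q} → p ⟶ q → V₁₀ q) → V₀₁ p
    options-V₁₀⇒V₀₁ {p} m₀ all =
        mex≡0 (sg p) (λ (_ , m , g≡0) → 0≢1+n (trans (sym g≡0) (proj₁ (all m))))
      , mex≡1 (misère-mex m₀) (_ , m₀ , proj₂ (all m₀)) (λ (_ , m , g⁻≡1) → 0≢1+n (trans (sym (proj₂ (all m))) g⁻≡1))

    options-Agree⇒Agree : ∀ {p q₀} → p ⟶ q₀ → (∀ {q} → p ⟶ q → Agree q) → Agree p
    options-Agree⇒Agree {p} m₀ all = mex-unique (sg p) (misère-mex m₀)
      (λ _ (q , m , e) → q , m , trans (sym (all m)) e)
      (λ _ (q , m , e) → q , m , trans (all m) e)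

    -- q₀ and q₁ supply the values 0 and 1 to both option sets; every other option agrees.
    balanced⇒Agree : ∀ {p} → (∀ {q} → p ⟶ q → V₀₁ q ⊎ V₁₀ q ⊎ Agree q) →
                     MovableTo G V₀₁ p → MovableTo G V₁₀ p → Agree p
    balanced⇒Agree {p} kinds (q₀ , m₀ , (g≡0 , g⁻≡1)) (q₁ , m₁ , (g≡1 , g⁻≡0)) =
      mex-unique (sg p) (misère-mex m₀) g⊆g⁻ g⁻⊆g
      where
      g⊆g⁻ : ∀ k → OptVals G g p k → OptVals G g⁻ p k
      g⊆g⁻ k (q , m , e) with kinds m
      ... | inj₁ (g≡0′ , _)        = q₁ , m₁ , trans g⁻≡0 (trans (sym g≡0′) e)
      ... | inj₂ (inj₁ (g≡1′ , _)) = q₀ , m₀ , trans g⁻≡1 (trans (sym g≡1′) e)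
      ... | inj₂ (inj₂ agree)       = q , m , trans (sym agree) e
      g⁻⊆g : ∀ k → OptVals G g⁻ p k → OptVals G g p k
      g⁻⊆g k (q , m , e) with kinds m
      ... | inj₁ (_ , g⁻≡1′)        = q₁ , m₁ , trans g≡1 (trans (sym g⁻≡1′) e)
      ... | inj₂ (inj₁ (_ , g⁻≡0′)) = q₀ , m₀ , trans g≡0 (trans (sym g⁻≡0′) e)
      ... | inj₂ (inj₂ agree)       = q , m , trans agree e

    options-Agree⇒isolated : ∀ {p} → (∀ {q} → p ⟶ q → Agree q) → ¬ MovableTo G (λ q → V₀₁ q ⊎ V₁₀ q) p
    options-Agree⇒isolated all (_ , m , inj₁ v) = V₀₁⇒¬Agree v (all m)
    options-Agree⇒isolated all (_ , m , inj₂ v) = V₁₀⇒¬Agree v (all m)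

    classify-single : ∀ {p p₁} → p ⟶ p₁ → (∀ {q} → p ⟶ q → q ≈ p₁) → Classified p₁ → Classified p
    classify-single {p} m₁ only c with kind c
    ... | inj₁ v = one-zero (options-V₀₁⇒V₁₀ m₁ all) all
      where
      all : ∀ {q} → p ⟶ q → V₀₁ q
      all m = ≈-V (only m) v
    ... | inj₂ (inj₁ v) = zero-one (options-V₁₀⇒V₀₁ m₁ all) all
      where
      all : ∀ {q} → p ⟶ q → V₁₀ q
      all m = ≈-V (only m) v
    ... | inj₂ (inj₂ agree) = isolated (options-Agree⇒Agree m₁ all) (options-Agree⇒isolated all)
      where
      all : ∀ {q} → p ⟶ q → Agree q
      all m = ≈-Agree (only m) agree

    classify-balanced : ∀ {p} → (∀ {q} → p ⟶ q → Classified q) →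
                        MovableTo G V₀₁ p → MovableTo G V₁₀ p → Classified p
    classify-balanced ih mv₀ mv₁ = balanced (balanced⇒Agree (λ m → kind (ih m)) mv₀ mv₁) mv₀ mv₁

    back⇒movable : ∀ {p p₁ i j} → (∀ {r} → p₁ ⟶ r → MovableTo G (r ≈_) p) →
                   MovableTo G (V G g g⁻ i j) p₁ → MovableTo G (V G g g⁻ i j) p
    back⇒movable back (_ , m , v) with back m
    ... | q , m′ , s = q , m′ , ≈-V (≈-sym s) v

    classify-chain : ∀ {p p₁ r} → p ⟶ p₁ → p₁ ⟶ r →
                     (∀ {q} → p ⟶ q → q ≈ p₁ ⊎ MovableTo G (q ≈_) p₁) →
                     (∀ {r} → p₁ ⟶ r → MovableTo G (r ≈_) p) →
                     (∀ {q} → p ⟶ q → Classified q) → Classified p₁ → Classified p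
    classify-chain {p₁ = p₁} m₁ m₁r _ back ih (zero-one v₁ all₁) =
      classify-balanced ih (p₁ , m₁ , v₁) (back⇒movable back (_ , m₁r , all₁ m₁r))
    classify-chain {p₁ = p₁} m₁ m₁r _ back ih (one-zero v₁ all₁) =
      classify-balanced ih (back⇒movable back (_ , m₁r , all₁ m₁r)) (p₁ , m₁ , v₁)
    classify-chain _ _ _ back ih (balanced _ mv₀ mv₁) =
      classify-balanced ih (back⇒movable back mv₀) (back⇒movable back mv₁)
    classify-chain {p} m₁ _ rest _ ih (isolated agree₁ ¬mv₁) =
      isolated (options-Agree⇒Agree m₁ all) (options-Agree⇒isolated all)
      where
      all : ∀ {q} → p ⟶ q → Agree q
      all m with rest m | kind (ih m)
      ... | inj₁ s             | _                 = ≈-Agree s agree₁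
      ... | inj₂ _             | inj₂ (inj₂ agree) = agree
      ... | inj₂ (q′ , m′ , s) | inj₁ v            = ⊥-elim (¬mv₁ (q′ , m′ , inj₁ (≈-V (≈-sym s) v)))
      ... | inj₂ (q′ , m′ , s) | inj₂ (inj₁ v)     = ⊥-elim (¬mv₁ (q′ , m′ , inj₂ (≈-V (≈-sym s) v)))

    classify : WellFounded (flip _⟶_) → (∀ p → Shape p) → ∀ p → Classified p
    classify wf shape p = go (wf p)
      where
      go : ∀ {p} → Acc (flip _⟶_) p → Classified p
      go {p} (acc rs) with shape p
      ... | terminal t            = zero-one (terminal⇒V₀₁ t) (λ {q} m → ⊥-elim (t q m))
      ... | single m₁ only        = classify-single m₁ only (go (rs m₁))
      ... | chain m₁ m₁r rest back = classify-chain m₁ m₁r rest back (λ m → go (rs m)) (go (rs m₁))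

    miserable×forced : WellFounded (flip _⟶_) → (∀ p → Shape p) → Miserable G g g⁻ × Forced G g g⁻
    miserable×forced wf shape = miserable , forced
      where
      miserable : Miserable G g g⁻
      miserable p with classify wf shape p
      ... | zero-one v _      = inj₁ (inj₁ v)
      ... | one-zero v _      = inj₁ (inj₂ v)
      ... | isolated _ ¬mv    = inj₂ (inj₁ ¬mv)
      ... | balanced _ mv₀ mv₁ = inj₂ (inj₂ (mv₀ , mv₁))
      forced : Forced G g g⁻
      forced p q m with classify wf shape p
      ... | zero-one v all    = (λ _ → all m) , (λ v′ → ⊥-elim (V₀₁⇒¬V₁₀ v v′))
      ... | one-zero v all    = (λ v′ → ⊥-elim (V₀₁⇒¬V₁₀ v′ v)) , (λ _ → all m)
      ... | isolated agree _  = (λ v → ⊥-elim (V₀₁⇒¬Agree v agree)) , (λ v → ⊥-elim (V₁₀⇒¬Agree v agree))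
      ... | balanced agree _ _ = (λ v → ⊥-elim (V₀₁⇒¬Agree v agree)) , (λ v → ⊥-elim (V₁₀⇒¬Agree v agree))

  measure⇒wellFounded : (μ : Pos G → ℕ) → (∀ {p q} → p ⟶ q → μ q < μ p) → WellFounded (flip _⟶_)
  measure⇒wellFounded μ decreasing = Subrelation.wellFounded decreasing (On.wellFounded μ <-wellFounded)

  shapes⇒miserable×forced : (μ : Pos G → ℕ) → (∀ {p q} → p ⟶ q → μ q < μ p) → (∀ p → Shape p) →
                            (g g⁻ : Pos G → ℕ) → IsSG G g → IsMisereSG G g⁻ →
                            Miserable G g g⁻ × Forced G g g⁻
  shapes⇒miserable×forced μ decreasing shape g g⁻ sg msg =
    Classification.miserable×forced g g⁻ sg msg (measure⇒wellFounded μ decreasing) shape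

y∸m*x∸n*x≡y∸[m+n]*x : ∀ y m n x → y ∸ m * x ∸ n * x ≡ y ∸ (m + n) * x
y∸m*x∸n*x≡y∸[m+n]*x y m n x =
  trans (∸-+-assoc y (m * x) (n * x)) (cong (y ∸_) (sym (*-distribʳ-+ x m n)))

[m+n]*x≤y⇒n*x≤y∸m*x : ∀ m n x y → (m + n) * x ≤ y → n * x ≤ y ∸ m * x
[m+n]*x≤y⇒n*x≤y∸m*x m n x y h =
  m+n≤o⇒m≤o∸n (n * x) (subst (_≤ y) (trans (*-distribʳ-+ x m n) (+-comm (m * x) (n * x))) h)

n*x≤y∸m*x⇒[m+n]*x≤y : ∀ m n x y → m * x ≤ y → n * x ≤ y ∸ m * x → (m + n) * x ≤ y
n*x≤y∸m*x⇒[m+n]*x≤y m n x y m*x≤y h =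
  subst (_≤ y) (trans (+-comm (n * x) (m * x)) (sym (*-distribʳ-+ x m n))) (m≤o∸n⇒m+n≤o (n * x) m*x≤y h)

y∸m*x<y : ∀ {m x y} → 1 ≤ m → 0 < x → m * x ≤ y → y ∸ m * x < y
y∸m*x<y m≥1 x>0 = ∸-monoʳ-< (*-mono-≤ m≥1 x>0)

1*x≤y : ∀ {x y} → x < y → 1 * x ≤ y
1*x≤y {x} x<y = ≤-trans (≤-reflexive (*-identityˡ x)) (<⇒≤ x<y)

[m+n]*x<y⇒n*x<y∸m*x : ∀ m n x y → (m + n) * x < y → n * x < y ∸ m * x
[m+n]*x<y⇒n*x<y∸m*x m n x y h =
  m+n≤o⇒m≤o∸n (suc (n * x)) (subst (_< y) (trans (*-distribʳ-+ x m n) (+-comm (m * x) (n * x))) h)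

n*x<y∸m*x⇒[m+n]*x<y : ∀ m n x y → m * x ≤ y → n * x < y ∸ m * x → (m + n) * x < y
n*x<y∸m*x⇒[m+n]*x<y m n x y m*x≤y h =
  subst (_< y) (trans (+-comm (n * x) (m * x)) (sym (*-distribʳ-+ x m n))) (m≤o∸n⇒m+n≤o (suc (n * x)) m*x≤y h)

x≤m*x : ∀ m x → 1 ≤ m → x ≤ m * x
x≤m*x (suc m) x _ = m≤n*m x (suc m)

1*x<y : ∀ {x y} → x < y → 1 * x < y
1*x<y {x} x<y = ≤-trans (s≤s (≤-reflexive (*-identityˡ x))) x<y

module ColeDavie where

  open GameShapes ColeDavieEuclid

  swap : ℕ × ℕ → ℕ × ℕ
  swap (x , y) = (y , x)

  swap-move : ∀ {p q} → p ⟶ q → swap p ⟶ swap q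
  swap-move (shrinkʸ m x>0 x≤y m≥1 h) = shrinkˣ m x>0 x≤y m≥1 h
  swap-move (shrinkˣ m y>0 y≤x m≥1 h) = shrinkʸ m y>0 y≤x m≥1 h

  open Symmetric swap (λ _ → refl) swap-move using (σ-shape)

  terminalˣ : ∀ {x y} → x ≡ 0 → Terminal ColeDavieEuclid (x , y)
  terminalˣ refl _ (shrinkʸ _ () _ _ _)
  terminalˣ refl _ (shrinkˣ _ y>0 y≤0 _ _) = <⇒≱ y>0 y≤0

  terminalʸ : ∀ {x y} → y ≡ 0 → Terminal ColeDavieEuclid (x , y)
  terminalʸ refl _ (shrinkˣ _ () _ _ _)
  terminalʸ refl _ (shrinkʸ _ x>0 x≤0 _ _) = <⇒≱ x>0 x≤0

  shrinkʸ-by : ∀ {x y} k → 0 < x → suc k * x ≤ y → (x , y) ⟶ (x , y ∸ suc k * x)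
  shrinkʸ-by {x} k x>0 h = shrinkʸ (suc k) x>0 (≤-trans (m≤n*m x (suc k)) h) (s≤s z≤n) h

  shape-diagonal : ∀ {x} → 0 < x → Shape (x , x)
  shape-diagonal {x} x>0 = single (shrinkʸ-by 0 x>0 (≤-reflexive (*-identityˡ x))) only
    where
    only : ∀ {q} → (x , x) ⟶ q → q ≈ (x , x ∸ 1 * x)
    only (shrinkʸ m _ _ m≥1 _) =
      inj₂ (terminalʸ (m≤n⇒m∸n≡0 (x≤m*x m x m≥1)) , terminalʸ (m≤n⇒m∸n≡0 (m≤n*m x 1)))
    only (shrinkˣ m _ _ m≥1 _) =
      inj₂ (terminalˣ (m≤n⇒m∸n≡0 (x≤m*x m x m≥1)) , terminalʸ (m≤n⇒m∸n≡0 (m≤n*m x 1)))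

  shape-x<y<2x : ∀ {x y} → 0 < x → x < y → y < 2 * x → Shape (x , y)
  shape-x<y<2x {x} {y} x>0 x<y y<2x = single (shrinkʸ-by 0 x>0 (1*x≤y x<y)) only
    where
    only : ∀ {q} → (x , y) ⟶ q → q ≈ (x , y ∸ 1 * x)
    only (shrinkʸ (suc zero) _ _ _ _)    = inj₁ refl
    only (shrinkʸ (suc (suc j)) _ _ _ h) =
      ⊥-elim (<⇒≱ y<2x (≤-trans (*-monoˡ-≤ x {2} {2 + j} (s≤s (s≤s z≤n))) h))
    only (shrinkˣ _ _ y≤x _ _)           = ⊥-elim (<⇒≱ x<y y≤x)

  shape-2x≤y : ∀ {x y} → 0 < x → x < y → 2 * x ≤ y → Shape (x , y)
  shape-2x≤y {x} {y} x>0 x<y 2x≤y =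
    chain (shrinkʸ-by 0 x>0 (1*x≤y x<y)) (shrinkʸ-by 0 x>0 x≤y∸x) rest back
    where
    x≤y∸x : 1 * x ≤ y ∸ 1 * x
    x≤y∸x = [m+n]*x≤y⇒n*x≤y∸m*x 1 1 x y 2x≤y
    rest : ∀ {q} → (x , y) ⟶ q → q ≈ (x , y ∸ 1 * x) ⊎ MovableTo ColeDavieEuclid (q ≈_) (x , y ∸ 1 * x)
    rest (shrinkʸ (suc zero) _ _ _ _)    = inj₁ (inj₁ refl)
    rest (shrinkʸ (suc (suc j)) _ _ _ h) =
      inj₂ (_ , shrinkʸ-by j x>0 ([m+n]*x≤y⇒n*x≤y∸m*x 1 (suc j) x y h) ,
            inj₁ (cong (x ,_) (sym (y∸m*x∸n*x≡y∸[m+n]*x y 1 (suc j) x))))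
    rest (shrinkˣ _ _ y≤x _ _)           = ⊥-elim (<⇒≱ x<y y≤x)
    back : ∀ {r} → (x , y ∸ 1 * x) ⟶ r → MovableTo ColeDavieEuclid (r ≈_) (x , y)
    back (shrinkʸ k _ _ k≥1 h) =
      _ , shrinkʸ (suc k) x>0 (<⇒≤ x<y) (s≤s z≤n) (n*x≤y∸m*x⇒[m+n]*x≤y 1 k x y (1*x≤y x<y) h) ,
      inj₁ (cong (x ,_) (y∸m*x∸n*x≡y∸[m+n]*x y 1 k x))
    back (shrinkˣ k _ y∸x≤x k≥1 _) =
      _ , shrinkʸ-by 1 x>0 2x≤y ,
      inj₂ (terminalˣ (m≤n⇒m∸n≡0 (≤-trans (≤-trans (m≤n*m x 1) x≤y∸x) (x≤m*x k _ k≥1))) ,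
            terminalʸ (trans (sym (y∸m*x∸n*x≡y∸[m+n]*x y 1 1 x)) (m≤n⇒m∸n≡0 (≤-trans y∸x≤x (m≤n*m x 1)))))

  shape-x<y : ∀ {x y} → 0 < x → x < y → Shape (x , y)
  shape-x<y {x} {y} x>0 x<y with 2 * x ≤? y
  ... | yes 2x≤y = shape-2x≤y x>0 x<y 2x≤y
  ... | no 2x≰y  = shape-x<y<2x x>0 x<y (≰⇒> 2x≰y)

  shape : ∀ p → Shape p
  shape (zero , _)        = terminal (terminalˣ refl)
  shape (suc x , zero)    = terminal (terminalʸ refl)
  shape (suc x , suc y) with <-cmp x y
  ... | tri< x<y _ _  = shape-x<y z<s (s≤s x<y)
  ... | tri≈ _ refl _ = shape-diagonal z<s
  ... | tri> _ _ y<x  = σ-shape (shape-x<y z<s (s≤s y<x))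

  moves-decrease-sum : ∀ {p q} → p ⟶ q → proj₁ q + proj₂ q < proj₁ p + proj₂ p
  moves-decrease-sum (shrinkʸ {x} m x>0 _ m≥1 m*x≤y) = +-monoʳ-< x (y∸m*x<y m≥1 x>0 m*x≤y)
  moves-decrease-sum (shrinkˣ {y = y} m y>0 _ m≥1 m*y≤x) = +-monoˡ-< y (y∸m*x<y m≥1 y>0 m*y≤x)

  miserable×forced : (g g⁻ : Pos ColeDavieEuclid → ℕ) → IsSG ColeDavieEuclid g → IsMisereSG ColeDavieEuclid g⁻ →
                     Miserable ColeDavieEuclid g g⁻ × Forced ColeDavieEuclid g g⁻
  miserable×forced = shapes⇒miserable×forced (λ p → proj₁ p + proj₂ p) moves-decrease-sum shape

module Grossman where

  open GameShapes GrossmanEuclid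

  swap : PosPair → PosPair
  swap p = ⟨ py p , px p ⟩∶ py+ p , px+ p

  swap-move : ∀ {p q} → p ⟶ q → swap p ⟶ swap q
  swap-move (inj₁ m) = inj₂ m
  swap-move (inj₂ m) = inj₁ m

  open Symmetric swap (λ _ → refl) (λ {p} {q} → swap-move {p} {q}) using (σ-shape)

  PosPair-≡ : ∀ {p q} → px p ≡ px q → py p ≡ py q → p ≡ q
  PosPair-≡ {⟨ x , y ⟩∶ x>0 , y>0} {⟨ .x , .y ⟩∶ x>0′ , y>0′} refl refl
    rewrite <-irrelevant x>0 x>0′ | <-irrelevant y>0 y>0′ = refl

  shrunkʸ : ∀ p m → m * px p < py p → PosPair
  shrunkʸ p m h = ⟨ px p , py p ∸ m * px p ⟩∶ px+ p , m<n⇒0<n∸m h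

  shrinkʸ-by : ∀ p m → px p < py p → 1 ≤ m → (h : m * px p < py p) → p ⟶ shrunkʸ p m h
  shrinkʸ-by p m x<y m≥1 h = inj₁ (x<y , refl , m , m≥1 , h , refl)

  shape-x<y≤2x : ∀ {p} → px p < py p → py p ≤ 2 * px p → Shape p
  shape-x<y≤2x {p@(⟨ x , y ⟩∶ _ , _)} x<y y≤2x =
    single {p₁ = shrunkʸ p 1 (1*x<y x<y)} (shrinkʸ-by p 1 x<y ≤-refl (1*x<y x<y)) only
    where
    only : ∀ {q} → p ⟶ q → q ≈ shrunkʸ p 1 (1*x<y x<y)
    only (inj₁ (_ , x′≡x , suc zero , _ , _ , y′≡)) = inj₁ (PosPair-≡ x′≡x y′≡)
    only (inj₁ (_ , _ , suc (suc j) , _ , h , _))   =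
      ⊥-elim (<⇒≱ h (≤-trans y≤2x (*-monoˡ-≤ x {2} {2 + j} (s≤s (s≤s z≤n)))))
    only (inj₂ (y<x , _)) = ⊥-elim (<-asym x<y y<x)

  shape-2x<y : ∀ {p} → 2 * px p < py p → Shape p
  shape-2x<y {p@(⟨ x , y ⟩∶ _ , _)} 2x<y =
    chain {p₁ = p₁} {r = shrunkʸ p₁ 1 1*x<y∸1*x}
          (shrinkʸ-by p 1 x<y ≤-refl (1*x<y x<y)) (shrinkʸ-by p₁ 1 x<y∸x ≤-refl 1*x<y∸1*x) rest back
    where
    x<y : x < y
    x<y = ≤-<-trans (m≤n*m x 2) 2x<y
    p₁ : PosPair
    p₁ = shrunkʸ p 1 (1*x<y x<y)
    1*x<y∸1*x : 1 * x < y ∸ 1 * x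
    1*x<y∸1*x = [m+n]*x<y⇒n*x<y∸m*x 1 1 x y 2x<y
    x<y∸x : x < y ∸ 1 * x
    x<y∸x = ≤-<-trans (m≤n*m x 1) 1*x<y∸1*x
    rest : ∀ {q} → p ⟶ q → q ≈ p₁ ⊎ MovableTo GrossmanEuclid (q ≈_) p₁
    rest (inj₁ (_ , x′≡x , suc zero , _ , _ , y′≡))     = inj₁ (inj₁ (PosPair-≡ x′≡x y′≡))
    rest (inj₁ (_ , x′≡x , suc (suc j) , _ , h , y′≡)) =
      inj₂ (shrunkʸ p₁ (suc j) h′ , shrinkʸ-by p₁ (suc j) x<y∸x (s≤s z≤n) h′ ,
            inj₁ (PosPair-≡ x′≡x (trans y′≡ (sym (y∸m*x∸n*x≡y∸[m+n]*x y 1 (suc j) x)))))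
      where
      h′ : suc j * x < y ∸ 1 * x
      h′ = [m+n]*x<y⇒n*x<y∸m*x 1 (suc j) x y h
    rest (inj₂ (y<x , _)) = ⊥-elim (<-asym x<y y<x)
    back : ∀ {r} → p₁ ⟶ r → MovableTo GrossmanEuclid (r ≈_) p
    back (inj₁ (_ , x′≡x , k , k≥1 , h , y′≡)) =
      shrunkʸ p (suc k) h′ , shrinkʸ-by p (suc k) x<y (s≤s z≤n) h′ ,
      inj₁ (PosPair-≡ x′≡x (trans y′≡ (y∸m*x∸n*x≡y∸[m+n]*x y 1 k x)))
      where
      h′ : suc k * x < y
      h′ = n*x<y∸m*x⇒[m+n]*x<y 1 k x y (<⇒≤ (1*x<y x<y)) h
    back (inj₂ (y∸x<x , _)) = ⊥-elim (<-asym x<y∸x y∸x<x)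

  shape-x<y : ∀ {p} → px p < py p → Shape p
  shape-x<y {p} x<y with 2 * px p <? py p
  ... | yes 2x<y = shape-2x<y 2x<y
  ... | no 2x≮y  = shape-x<y≤2x x<y (≮⇒≥ 2x≮y)

  diagonal-terminal : ∀ {p} → px p ≡ py p → Terminal GrossmanEuclid p
  diagonal-terminal x≡y _ (inj₁ (x<y , _)) = <-irrefl x≡y x<y
  diagonal-terminal x≡y _ (inj₂ (y<x , _)) = <-irrefl (sym x≡y) y<x

  shape : ∀ p → Shape p
  shape p with <-cmp (px p) (py p)
  ... | tri< x<y _ _   = shape-x<y x<y
  ... | tri≈ _ x≡y _   = terminal (diagonal-terminal {p} x≡y)
  ... | tri> _ _ y<x   = σ-shape (shape-x<y {swap p} y<x)

  moves-decrease-sum : ∀ {p q} → p ⟶ q → px q + py q < px p + py p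
  moves-decrease-sum {p} (inj₁ (_ , x′≡x , m , m≥1 , h , y′≡)) rewrite x′≡x | y′≡ =
    +-monoʳ-< (px p) (y∸m*x<y m≥1 (px+ p) (<⇒≤ h))
  moves-decrease-sum {p} (inj₂ (_ , y′≡y , m , m≥1 , h , x′≡)) rewrite x′≡ | y′≡y =
    +-monoˡ-< (py p) (y∸m*x<y m≥1 (py+ p) (<⇒≤ h))

  miserable×forced : (g g⁻ : Pos GrossmanEuclid → ℕ) → IsSG GrossmanEuclid g → IsMisereSG GrossmanEuclid g⁻ →
                     Miserable GrossmanEuclid g g⁻ × Forced GrossmanEuclid g g⁻
  miserable×forced = shapes⇒miserable×forced (λ p → px p + py p) (λ {p} {q} → moves-decrease-sum {p} {q}) shape

proposition6p8 :
  ((g g⁻ : Pos ColeDavieEuclid → ℕ) → IsSG ColeDavieEuclid g → IsMisereSG ColeDavieEuclid g⁻ →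
      Miserable ColeDavieEuclid g g⁻ × Forced ColeDavieEuclid g g⁻)
  × ((g g⁻ : Pos GrossmanEuclid → ℕ) → IsSG GrossmanEuclid g → IsMisereSG GrossmanEuclid g⁻ →
      Miserable GrossmanEuclid g g⁻ × Forced GrossmanEuclid g g⁻)
proposition6p8 = ColeDavie.miserable×forced , Grossman.miserable×forced
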